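{- Let $w\in S_n$ and let $C$ be a commutation class of reduced words for $w$, with heap poset $P_C$ on $\operatorname{Inv}(w)$. If $ab,cd\in\operatorname{Inv}(w)$ satisfy $|\{a,b\}\cap\{c,d\}|=1$, then $ab$ and $cd$ are comparable in $P_C$.
   Context: For $w=(w_1,\dots,w_n)\in S_n$, $<_w$ denotes the linear order $w_1<_w\cdots<_w w_n$ on $[n]$, and $\operatorname{Inv}(w)=\{(a,b):1\le a<b\le n,\ b<_w a\}$, pairs written $ab$. Let $s_i$ be the adjacent transposition of $i,i+1$; $ws_i$ is obtained from $w$ by swapping the entries in positions $i,i+1$. A reduced word for $w$ is $(i_1,\dots,i_\ell)$ with $w=s_{i_1}\cdots s_{i_\ell}$, $\ell=|\operatorname{Inv}(w)|$. The commutation class $C(\mathbf i)$ is the set of words obtained from $\mathbf i$ by repeatedly swapping adjacent entries differing by at least $2$. The heap poset $P_C$ on $\operatorname{Inv}(w)$: fix $\mathbf i=(i_1,\dots,i_\ell)\in C$, let $x_j$ be the unique element of $\operatorname{Inv}(s_{i_1}\cdots s_{i_j})\setminus\operatorname{Inv}(s_{i_1}\cdots s_{i_{j-1}})$; $P_C$ is the transitive closure of the relations $x_j<x_k$ for $j<k$ with $|i_j-i_k|\le 1$ (independent of the choice of $\mathbf i\in C$). -}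

module Defs where

open import Data.Nat using (ℕ; zero; suc; _<_; _≤_; _∸_; _<ᵇ_; ∣_-_∣)
open import Data.Nat.Properties using (_≟_)
open import Data.Bool using (if_then_else_)
open import Data.Fin using (Fin; toℕ) renaming (_<_ to _<ᶠ_)
open import Data.List using (List; []; _∷_; _++_; map; upTo; foldl; take; length; lookup; filter; concatMap)
open import Data.List.Relation.Unary.All using (All)
open import Data.List.Membership.Propositional using (_∈_; _∉_)
open import Data.List.Membership.DecPropositional _≟_ using (_∈?_)
open import Data.Product using (_×_; _,_; ∃-syntax)
open import Data.Sum using (_⊎_)
open import Relation.Binary.PropositionalEquality using (_≡_)
open import Relation.Binary.Construct.Closure.ReflexiveTransitive using (Star)

-- Permutations of [n] are represented in one-line notation as lists
-- w = (w_1, ..., w_n) of natural numbers (values 1..n).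

idPerm : ℕ → List ℕ
idPerm n = map suc (upTo n)

-- w s_i : swap the entries in positions i, i+1 (positions are 1-based)
swapAt : ℕ → List ℕ → List ℕ
swapAt (suc zero)    (x ∷ y ∷ r) = y ∷ x ∷ r
swapAt (suc (suc k)) (x ∷ r)     = x ∷ swapAt (suc k) r
swapAt _             w           = w

-- the permutation s_{i_1} s_{i_2} ... s_{i_l} in S_n (one-line notation)
prod : ℕ → List ℕ → List ℕ
prod n 𝐢 = foldl (λ w i → swapAt i w) (idPerm n) 𝐢

-- Inv(w) = { (a,b) : a < b, b <_w a }, listed explicitly:
-- for each entry x = w_j, the pairs (y , x) with y appearing later and y < x.
inv : List ℕ → List (ℕ × ℕ)
inv []       = []
inv (x ∷ xs) = concatMap (λ y → if y <ᵇ x then (y , x) ∷ [] else []) xs ++ inv xs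

ReducedWordFor : ℕ → List ℕ → List ℕ → Set
ReducedWordFor n w 𝐢 =
  All (λ i → 1 ≤ i × i < n) 𝐢 × prod n 𝐢 ≡ w × length 𝐢 ≡ length (inv w)

-- x_j (0-based index j, i.e. the (j+1)-st letter): x is the element of
-- Inv(s_{i_1}...s_{i_{j+1}}) \ Inv(s_{i_1}...s_{i_j})
IsX : ℕ → (𝐢 : List ℕ) → Fin (length 𝐢) → ℕ × ℕ → Set
IsX n 𝐢 j x = x ∈ inv (prod n (take (suc (toℕ j)) 𝐢)) × x ∉ inv (prod n (take (toℕ j) 𝐢))

HeapGen : ℕ → List ℕ → ℕ × ℕ → ℕ × ℕ → Set
HeapGen n 𝐢 x y =
  ∃[ j ] ∃[ k ] (j <ᶠ k × ∣ lookup 𝐢 j - lookup 𝐢 k ∣ ≤ 1 × IsX n 𝐢 j x × IsX n 𝐢 k y)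

-- the order ≤ of the heap poset P_C, C = C(𝐢): reflexive-transitive closure
HeapLeq : ℕ → List ℕ → ℕ × ℕ → ℕ × ℕ → Set
HeapLeq n 𝐢 = Star (HeapGen n 𝐢)

Comparable : ℕ → List ℕ → ℕ × ℕ → ℕ × ℕ → Set
Comparable n 𝐢 x y = HeapLeq n 𝐢 x y ⊎ HeapLeq n 𝐢 y x

interSize : ℕ → ℕ → ℕ → ℕ → ℕ
interSize a b c d = length (filter (_∈? (c ∷ d ∷ [])) (a ∷ b ∷ []))

-- A letter s_i adds at most one inversion, namely the pair of entries it exchanges at
-- positions i and i+1.  A reduced word for w reaches |Inv(w)| inversions in as many letters,
-- so every letter adds one: the element x_j sits at positions i_j, i_j + 1 just before step j.
-- Let v be the entry shared by ab and cd, with ab created first.  Right after ab is created,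
-- v sits at a position touched by the letter of ab.  Follow v through the later letters: a
-- letter that moves v touches a position also touched by the letter of the last element
-- recorded, so the two letters differ by at most 1 and the heap relates their elements.
-- When cd is created, v is one of the two exchanged entries, which closes the chain.

module Submission where

open import Defs
open import Data.Bool using (true; false; if_then_else_)
open import Data.Fin using (Fin; toℕ; fromℕ<) renaming (zero to fzero; suc to fsuc)
open import Data.Fin.Properties using (toℕ<n; toℕ-fromℕ<; toℕ-injective)
open import Data.List using (List; []; _∷_; _++_; concatMap; filter; foldl; take; length; lookup)
open import Data.List.Properties using (length-++; ++-assoc; filter-accept; filter-reject)
open import Data.List.Membership.Propositional using (_∈_; _∉_)
open import Data.List.Membership.Propositional.Properties using (∉[]; ∈-++⁺ʳ; ∈-++⁻)
open import Data.List.Relation.Binary.Permutation.Propositional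
  using (_↭_; refl; prep; swap; trans; ↭-refl; ↭-sym; ↭-trans; ↭-reflexive; module PermutationReasoning)
open import Data.List.Relation.Binary.Permutation.Propositional.Properties
  using (All-resp-↭; ∈-resp-↭; ↭-length; ++⁺ˡ; ++⁺ʳ; ++⁺; shift; shifts)
open import Data.List.Relation.Unary.All as All using (All; []; _∷_)
open import Data.List.Relation.Unary.AllPairs as AllPairs using (AllPairs; []; _∷_)
import Data.List.Relation.Unary.AllPairs.Properties as AllPairsₚ
open import Data.List.Relation.Unary.Any using (here; there)
open import Data.List.Relation.Unary.Unique.Propositional using (Unique)
open import Data.Nat using (ℕ; zero; suc; z≤n; s≤s; _+_; _<_; _≤_; _<ᵇ_; _≤′_; ≤′-refl; ≤′-step; ∣_-_∣)
open import Data.Nat.Properties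
open import Data.Product using (_×_; _,_; proj₁; proj₂; ∃; ∃₂)
open import Data.Product.Properties using (≡-dec)
open import Data.Sum as Sum using (_⊎_; inj₁; inj₂)
open import Function using (_∘_)
open import Relation.Binary.Construct.Closure.ReflexiveTransitive using (ε; _◅_; _◅◅_)
open import Relation.Binary.Definitions using (tri<; tri≈; tri>)
open import Relation.Binary.PropositionalEquality as ≡
  using (_≡_; refl; sym; cong; cong₂; subst; ≢-sym; module ≡-Reasoning)
open import Relation.Nullary using (¬_; Dec; yes; no; contradiction)
open import Relation.Nullary.Decidable using (_⊎-dec_)

open import Data.List.Membership.DecPropositional _≟_ using (_∈?_)
open import Data.List.Membership.DecPropositional (≡-dec _≟_ _≟_) using () renaming (_∈?_ to _∈²?_)

pairIfSmaller : ℕ → ℕ → List (ℕ × ℕ)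
pairIfSmaller x y = if y <ᵇ x then (y , x) ∷ [] else []

smallerPairs : ℕ → List ℕ → List (ℕ × ℕ)
smallerPairs x = concatMap (pairIfSmaller x)

∈-smallerPairs⁻ : ∀ {p q x} xs → (p , q) ∈ smallerPairs x xs → p ∈ xs × q ≡ x × p < x
∈-smallerPairs⁻ {x = x} (y ∷ ys) m with y <ᵇ x | <ᵇ⇒< y x
... | false | _ = let (p∈ys , q≡x , p<x) = ∈-smallerPairs⁻ ys m in there p∈ys , q≡x , p<x
... | true | y<x with m
...   | here refl = here refl , refl , y<x _
...   | there m′ = let (p∈ys , q≡x , p<x) = ∈-smallerPairs⁻ ys m′ in there p∈ys , q≡x , p<x

smallerPairs-↭ : ∀ z {xs ys} → xs ↭ ys → smallerPairs z xs ↭ smallerPairs z ys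
smallerPairs-↭ z refl = ↭-refl
smallerPairs-↭ z (prep x xs↭ys) = ++⁺ˡ (pairIfSmaller z x) (smallerPairs-↭ z xs↭ys)
smallerPairs-↭ z (swap x y xs↭ys) = trans (shifts (pairIfSmaller z x) (pairIfSmaller z y))
  (++⁺ˡ (pairIfSmaller z y) (++⁺ˡ (pairIfSmaller z x) (smallerPairs-↭ z xs↭ys)))
smallerPairs-↭ z (trans xs↭ys ys↭zs) = trans (smallerPairs-↭ z xs↭ys) (smallerPairs-↭ z ys↭zs)

smallerPairs-[] : ∀ {x xs} → All (x <_) xs → smallerPairs x xs ≡ []
smallerPairs-[] [] = refl
smallerPairs-[] {x} {y ∷ _} (x<y ∷ x<ys) with y <ᵇ x | <ᵇ⇒< y x
... | false | _ = smallerPairs-[] x<ys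
... | true | y<x = contradiction (y<x _) (<-asym x<y)

∈-inv⁻ : ∀ {p q} u → (p , q) ∈ inv u → p ∈ u × q ∈ u
∈-inv⁻ (x ∷ xs) m with ∈-++⁻ (smallerPairs x xs) m
... | inj₁ m′ = let (p∈xs , q≡x , _) = ∈-smallerPairs⁻ xs m′ in there p∈xs , here q≡x
... | inj₂ m′ = let (p∈xs , q∈xs) = ∈-inv⁻ xs m′ in there p∈xs , there q∈xs

inv-sorted : ∀ {u} → AllPairs _<_ u → inv u ≡ []
inv-sorted [] = refl
inv-sorted (x<xs ∷ sorted) = cong₂ _++_ (smallerPairs-[] x<xs) (inv-sorted sorted)

idPerm-sorted : ∀ n → AllPairs _<_ (idPerm n)
idPerm-sorted n = AllPairsₚ.map⁺ (AllPairsₚ.applyUpTo⁺₁ (λ i → i) n (λ i<j _ → s≤s i<j))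

inv-idPerm : ∀ n → inv (idPerm n) ≡ []
inv-idPerm n = inv-sorted (idPerm-sorted n)

Unique-idPerm : ∀ n → Unique (idPerm n)
Unique-idPerm n = AllPairs.map <⇒≢ (idPerm-sorted n)

data EntryAt : List ℕ → ℕ → ℕ → Set where
  here  : ∀ {x xs} → EntryAt (x ∷ xs) 1 x
  there : ∀ {x xs k v} → EntryAt xs (suc k) v → EntryAt (x ∷ xs) (suc (suc k)) v

EntryAt-functional : ∀ {u p x y} → EntryAt u p x → EntryAt u p y → x ≡ y
EntryAt-functional here here = refl
EntryAt-functional (there a) (there b) = EntryAt-functional a b

EntryAt⇒∈ : ∀ {u p x} → EntryAt u p x → x ∈ u
EntryAt⇒∈ here = here refl
EntryAt⇒∈ (there a) = there (EntryAt⇒∈ a)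

EntryAt-injective : ∀ {u p q x} → Unique u → EntryAt u p x → EntryAt u q x → p ≡ q
EntryAt-injective _ here here = refl
EntryAt-injective (x∉xs ∷ _) here (there b) = contradiction refl (All.lookup x∉xs (EntryAt⇒∈ b))
EntryAt-injective (x∉xs ∷ _) (there a) here = contradiction refl (All.lookup x∉xs (EntryAt⇒∈ a))
EntryAt-injective (_ ∷ U) (there a) (there b) = cong suc (EntryAt-injective U a b)

swapAt-↭ : ∀ i u → swapAt i u ↭ u
swapAt-↭ zero          u           = ↭-refl
swapAt-↭ (suc zero)    []          = ↭-refl
swapAt-↭ (suc zero)    (x ∷ [])    = ↭-refl
swapAt-↭ (suc zero)    (x ∷ y ∷ r) = swap y x ↭-refl
swapAt-↭ (suc (suc k)) []          = ↭-refl
swapAt-↭ (suc (suc k)) (x ∷ r)     = prep x (swapAt-↭ (suc k) r)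

Unique-swapAt : ∀ i {u} → Unique u → Unique (swapAt i u)
Unique-swapAt zero          U = U
Unique-swapAt (suc zero)    {[]}        U = U
Unique-swapAt (suc zero)    {x ∷ []}    U = U
Unique-swapAt (suc zero)    {x ∷ y ∷ r} ((x≢y ∷ x∉r) ∷ y∉r ∷ U) = (≢-sym x≢y ∷ y∉r) ∷ x∉r ∷ U
Unique-swapAt (suc (suc k)) {[]}        U = U
Unique-swapAt (suc (suc k)) {x ∷ r}     (x∉r ∷ U) =
  All-resp-↭ (↭-sym (swapAt-↭ (suc k) r)) x∉r ∷ Unique-swapAt (suc k) U

Touches : ℕ → ℕ → Set
Touches i p = p ≡ i ⊎ p ≡ suc i

touches? : ∀ i p → Dec (Touches i p)
touches? i p = p ≟ i ⊎-dec p ≟ suc i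

swapAt-exchanges : ∀ {u i x y} → EntryAt u i x → EntryAt u (suc i) y →
  EntryAt (swapAt i u) i y × EntryAt (swapAt i u) (suc i) x
swapAt-exchanges here      (there here) = here , there here
swapAt-exchanges (there a) (there b)    = let (b′ , a′) = swapAt-exchanges a b in there b′ , there a′

swapAt-keeps-touched : ∀ {u i x y p z} → EntryAt u i x → EntryAt u (suc i) y → EntryAt u p z →
  Touches i p → ∃ λ p′ → EntryAt (swapAt i u) p′ z × Touches i p′
swapAt-keeps-touched at-i at-i+1 at-p (inj₁ refl) rewrite EntryAt-functional at-p at-i =
  _ , proj₂ (swapAt-exchanges at-i at-i+1) , inj₂ refl
swapAt-keeps-touched at-i at-i+1 at-p (inj₂ refl) rewrite EntryAt-functional at-p at-i+1 =
  _ , proj₁ (swapAt-exchanges at-i at-i+1) , inj₁ refl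

swapAt-keeps-untouched : ∀ {u i x y p z} → EntryAt u i x → EntryAt u (suc i) y → EntryAt u p z →
  ¬ Touches i p → EntryAt (swapAt i u) p z
swapAt-keeps-untouched here (there here) here          ¬touches = contradiction (inj₁ refl) ¬touches
swapAt-keeps-untouched here (there here) (there here)  ¬touches = contradiction (inj₂ refl) ¬touches
swapAt-keeps-untouched here (there here) (there (there c)) _    = there (there c)
swapAt-keeps-untouched (there a) (there b) here        _        = here
swapAt-keeps-untouched (there a) (there b) (there c)   ¬touches =
  there (swapAt-keeps-untouched a b c (¬touches ∘ Sum.map (cong suc) (cong suc)))

AddsInversion : ℕ → List ℕ → Set
AddsInversion i u = ∃₂ λ p q → EntryAt u i p × EntryAt u (suc i) q × inv (swapAt i u) ↭ (p , q) ∷ inv u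

AddsNoInversion : ℕ → List ℕ → Set
AddsNoInversion i u = ∃ λ lost → inv u ↭ lost ++ inv (swapAt i u)

inv-swapAt-head : ∀ x y r → AddsInversion 1 (x ∷ y ∷ r) ⊎ AddsNoInversion 1 (x ∷ y ∷ r)
inv-swapAt-head x y r with x <ᵇ y | <ᵇ⇒< x y | y <ᵇ x | <ᵇ⇒< y x
... | true  | x<y | true  | y<x = contradiction (y<x _) (<-asym (x<y _))
... | true  | _   | false | _   =
  inj₁ (x , y , here , there here , prep (x , y) (shifts (smallerPairs y r) (smallerPairs x r)))
... | false | _   | b     | _   = inj₂ (lost , lost↭)
  where
  lost : List (ℕ × ℕ)
  lost = if b then (y , x) ∷ [] else []
  -- inv (x ∷ y ∷ r) ↭ lost ++ inv (y ∷ x ∷ r), unfolded with y <ᵇ x abstracted to b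
  lost↭ : (lost ++ smallerPairs x r) ++ smallerPairs y r ++ inv r
        ↭ lost ++ smallerPairs y r ++ smallerPairs x r ++ inv r
  lost↭ = ↭-trans (↭-reflexive (++-assoc lost _ _)) (++⁺ˡ lost (shifts (smallerPairs x r) (smallerPairs y r)))

inv-swapAt-there : ∀ x k r → AddsInversion (suc k) r ⊎ AddsNoInversion (suc k) r →
  AddsInversion (suc (suc k)) (x ∷ r) ⊎ AddsNoInversion (suc (suc k)) (x ∷ r)
inv-swapAt-there x k r (inj₁ (p , q , at-p , at-q , added)) = inj₁ (p , q , there at-p , there at-q , added′)
  where
  open PermutationReasoning
  added′ : smallerPairs x (swapAt (suc k) r) ++ inv (swapAt (suc k) r) ↭ (p , q) ∷ smallerPairs x r ++ inv r
  added′ = begin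
    smallerPairs x (swapAt (suc k) r) ++ inv (swapAt (suc k) r)
      ↭⟨ ++⁺ (smallerPairs-↭ x (swapAt-↭ (suc k) r)) added ⟩
    smallerPairs x r ++ (p , q) ∷ inv r
      ↭⟨ shift (p , q) (smallerPairs x r) (inv r) ⟩
    (p , q) ∷ smallerPairs x r ++ inv r
      ∎
inv-swapAt-there x k r (inj₂ (lost , lost↭)) = inj₂ (lost , lost↭′)
  where
  open PermutationReasoning
  lost↭′ : smallerPairs x r ++ inv r ↭ lost ++ smallerPairs x (swapAt (suc k) r) ++ inv (swapAt (suc k) r)
  lost↭′ = begin
    smallerPairs x r ++ inv r
      ↭⟨ ++⁺ˡ (smallerPairs x r) lost↭ ⟩
    smallerPairs x r ++ lost ++ inv (swapAt (suc k) r)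
      ↭⟨ shifts (smallerPairs x r) lost ⟩
    lost ++ smallerPairs x r ++ inv (swapAt (suc k) r)
      ↭⟨ ++⁺ˡ lost (++⁺ʳ _ (smallerPairs-↭ x (↭-sym (swapAt-↭ (suc k) r)))) ⟩
    lost ++ smallerPairs x (swapAt (suc k) r) ++ inv (swapAt (suc k) r)
      ∎

inv-swapAt : ∀ i u → AddsInversion i u ⊎ AddsNoInversion i u
inv-swapAt zero          u           = inj₂ ([] , ↭-refl)
inv-swapAt (suc zero)    []          = inj₂ ([] , ↭-refl)
inv-swapAt (suc zero)    (x ∷ [])    = inj₂ ([] , ↭-refl)
inv-swapAt (suc zero)    (x ∷ y ∷ r) = inv-swapAt-head x y r
inv-swapAt (suc (suc k)) []          = inj₂ ([] , ↭-refl)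
inv-swapAt (suc (suc k)) (x ∷ r)     = inv-swapAt-there x k r (inv-swapAt (suc k) r)

invCount : List ℕ → ℕ
invCount u = length (inv u)

AddsNoInversion⇒invCount≤ : ∀ {i u} → AddsNoInversion i u → invCount (swapAt i u) ≤ invCount u
AddsNoInversion⇒invCount≤ {i} {u} (lost , lost↭) = begin
  invCount (swapAt i u)                 ≤⟨ m≤n+m _ (length lost) ⟩
  length lost + invCount (swapAt i u)   ≡⟨ length-++ lost ⟨
  length (lost ++ inv (swapAt i u))     ≡⟨ ↭-length lost↭ ⟨
  invCount u                            ∎
  where open ≤-Reasoning

invCount-swapAt≤ : ∀ i u → invCount (swapAt i u) ≤ suc (invCount u)
invCount-swapAt≤ i u with inv-swapAt i u
... | inj₁ (_ , _ , _ , _ , added) = ≤-reflexive (↭-length added)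
... | inj₂ loses                   = m≤n⇒m≤1+n (AddsNoInversion⇒invCount≤ {i} {u} loses)

invCount-grows⇒AddsInversion : ∀ i u → invCount u < invCount (swapAt i u) → AddsInversion i u
invCount-grows⇒AddsInversion i u grows with inv-swapAt i u
... | inj₁ adds  = adds
... | inj₂ loses = contradiction (AddsNoInversion⇒invCount≤ {i} {u} loses) (<⇒≱ grows)

adjacent∉inv : ∀ {u i p q} → Unique u → EntryAt u i p → EntryAt u (suc i) q → (p , q) ∉ inv u
adjacent∉inv {x ∷ xs} (x∉xs ∷ U) at-p (there at-q) m with ∈-++⁻ (smallerPairs x xs) m
... | inj₁ m′ = All.lookup x∉xs (EntryAt⇒∈ at-q) (sym (proj₁ (proj₂ (∈-smallerPairs⁻ xs m′))))
adjacent∉inv {x ∷ xs} (x∉xs ∷ U) here (there at-q) m | inj₂ m′ =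
  All.lookup x∉xs (proj₁ (∈-inv⁻ xs m′)) refl
adjacent∉inv {x ∷ xs} (x∉xs ∷ U) (there at-p) (there at-q) m | inj₂ m′ =
  adjacent∉inv U at-p at-q m′

AddsInversion⇒creates : ∀ {i u} → Unique u → AddsInversion i u → ∃ λ x → x ∈ inv (swapAt i u) × x ∉ inv u
AddsInversion⇒creates U (p , q , at-p , at-q , added) =
  (p , q) , ∈-resp-↭ (↭-sym added) (here refl) , adjacent∉inv U at-p at-q

new-inversion-positions : ∀ {p q} i u → (p , q) ∈ inv (swapAt i u) → (p , q) ∉ inv u →
  EntryAt u i p × EntryAt u (suc i) q
new-inversion-positions i u new ∉old with inv-swapAt i u
... | inj₂ (lost , lost↭) = contradiction (∈-resp-↭ (↭-sym lost↭) (∈-++⁺ʳ lost new)) ∉old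
... | inj₁ (_ , _ , at-p , at-q , added) with ∈-resp-↭ added new
...   | here refl = at-p , at-q
...   | there old = contradiction old ∉old

applySwaps : List ℕ → List ℕ → List ℕ
applySwaps z is = foldl (λ w i → swapAt i w) z is

CreatedAt : List ℕ → (is : List ℕ) → Fin (length is) → ℕ × ℕ → Set
CreatedAt z is j x = x ∈ inv (applySwaps z (take (suc (toℕ j)) is)) × x ∉ inv (applySwaps z (take (toℕ j) is))

applySwaps-take-suc : ∀ z is (j : Fin (length is)) →
  applySwaps z (take (suc (toℕ j)) is) ≡ swapAt (lookup is j) (applySwaps z (take (toℕ j) is))
applySwaps-take-suc z (i ∷ is) fzero    = refl
applySwaps-take-suc z (i ∷ is) (fsuc j) = applySwaps-take-suc (swapAt i z) is j

Unique-applySwaps : ∀ {z} is → Unique z → Unique (applySwaps z is)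
Unique-applySwaps []       U = U
Unique-applySwaps (i ∷ is) U = Unique-applySwaps is (Unique-swapAt i U)

invCount-applySwaps≤ : ∀ z is → invCount (applySwaps z is) ≤ invCount z + length is
invCount-applySwaps≤ z []       = m≤m+n (invCount z) 0
invCount-applySwaps≤ z (i ∷ is) = begin
  invCount (applySwaps (swapAt i z) is) ≤⟨ invCount-applySwaps≤ (swapAt i z) is ⟩
  invCount (swapAt i z) + length is     ≤⟨ +-monoˡ-≤ (length is) (invCount-swapAt≤ i z) ⟩
  suc (invCount z) + length is          ≡⟨ +-suc (invCount z) (length is) ⟨
  invCount z + suc (length is)          ∎
  where open ≤-Reasoning

invCount-tight-head : ∀ z i is → invCount (applySwaps z (i ∷ is)) ≡ invCount z + length (i ∷ is) →
  invCount (swapAt i z) ≡ suc (invCount z)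
invCount-tight-head z i is tight = ≤-antisym (invCount-swapAt≤ i z) (+-cancelʳ-≤ (length is) _ _ (begin
  suc (invCount z) + length is          ≡⟨ +-suc (invCount z) (length is) ⟨
  invCount z + suc (length is)          ≡⟨ tight ⟨
  invCount (applySwaps (swapAt i z) is) ≤⟨ invCount-applySwaps≤ (swapAt i z) is ⟩
  invCount (swapAt i z) + length is     ∎))
  where open ≤-Reasoning

every-swap-creates : ∀ {z} is → Unique z → invCount (applySwaps z is) ≡ invCount z + length is →
  (j : Fin (length is)) → ∃ (CreatedAt z is j)
every-swap-creates {z} (i ∷ is) U tight fzero =
  AddsInversion⇒creates U (invCount-grows⇒AddsInversion i z (≤-reflexive (sym (invCount-tight-head z i is tight))))
every-swap-creates {z} (i ∷ is) U tight (fsuc j) = every-swap-creates is (Unique-swapAt i U) tight′ j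
  where
  tight′ : invCount (applySwaps (swapAt i z) is) ≡ invCount (swapAt i z) + length is
  tight′ = begin
    invCount (applySwaps (swapAt i z) is) ≡⟨ tight ⟩
    invCount z + suc (length is)          ≡⟨ +-suc (invCount z) (length is) ⟩
    suc (invCount z) + length is          ≡⟨ cong (_+ length is) (invCount-tight-head z i is tight) ⟨
    invCount (swapAt i z) + length is     ∎
    where open ≡-Reasoning

first-creation : ∀ z is {x} → x ∉ inv z → x ∈ inv (applySwaps z is) → ∃ λ j → CreatedAt z is j x
first-creation z []       x∉ x∈ = contradiction x∈ x∉
first-creation z (i ∷ is) {x} x∉ x∈ with x ∈²? inv (swapAt i z)
... | yes x∈′ = fzero , x∈′ , x∉
... | no  x∉′ = let (j , created) = first-creation (swapAt i z) is x∉′ x∈ in fsuc j , created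

∣n-1+n∣≡1 : ∀ n → ∣ n - suc n ∣ ≡ 1
∣n-1+n∣≡1 zero    = refl
∣n-1+n∣≡1 (suc n) = ∣n-1+n∣≡1 n

touching⇒∣-∣≤1 : ∀ {i j p} → Touches i p → Touches j p → ∣ i - j ∣ ≤ 1
touching⇒∣-∣≤1 {i} (inj₁ refl) (inj₁ refl) = ≤-trans (≤-reflexive (∣n-n∣≡0 i)) z≤n
touching⇒∣-∣≤1 {j = j} (inj₁ refl) (inj₂ refl) = ≤-reflexive (≡.trans (∣-∣-comm (suc j) j) (∣n-1+n∣≡1 j))
touching⇒∣-∣≤1 {i} (inj₂ refl) (inj₁ refl) = ≤-reflexive (∣n-1+n∣≡1 i)
touching⇒∣-∣≤1 {i} (inj₂ refl) (inj₂ refl) = ≤-trans (≤-reflexive (∣n-n∣≡0 i)) z≤n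

pair-entry-touches : ∀ {u i c d v} → v ∈ c ∷ d ∷ [] → EntryAt u i c → EntryAt u (suc i) d →
  ∃ λ p → EntryAt u p v × Touches i p
pair-entry-touches (here refl)         at-c _    = _ , at-c , inj₁ refl
pair-entry-touches (there (here refl)) _    at-d = _ , at-d , inj₂ refl

module _ {n : ℕ} {𝐢 : List ℕ} where

  after : ℕ → List ℕ
  after m = prod n (take m 𝐢)

  after-suc : ∀ {j r v} → EntryAt (swapAt (lookup 𝐢 j) (after (toℕ j))) r v →
              EntryAt (after (suc (toℕ j))) r v
  after-suc {j} = subst (λ u → EntryAt u _ _) (sym (applySwaps-take-suc (idPerm n) 𝐢 j))

  IsX-positions : ∀ {j p q} → IsX n 𝐢 j (p , q) →
    EntryAt (after (toℕ j)) (lookup 𝐢 j) p × EntryAt (after (toℕ j)) (suc (lookup 𝐢 j)) q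
  IsX-positions {j} (new , ∉old) =
    new-inversion-positions (lookup 𝐢 j) _
      (subst (λ u → _ ∈ inv u) (applySwaps-take-suc (idPerm n) 𝐢 j) new) ∉old

  IsX-functional : ∀ {j x y} → IsX n 𝐢 j x → IsX n 𝐢 j y → x ≡ y
  IsX-functional {x = _ , _} {y = _ , _} isX isY =
    cong₂ _,_ (EntryAt-functional (proj₁ (IsX-positions isX)) (proj₁ (IsX-positions isY)))
              (EntryAt-functional (proj₂ (IsX-positions isX)) (proj₂ (IsX-positions isY)))

  touching⇒HeapGen : ∀ {s t p x y} → toℕ s < toℕ t → Touches (lookup 𝐢 s) p → Touches (lookup 𝐢 t) p →
    IsX n 𝐢 s x → IsX n 𝐢 t y → HeapGen n 𝐢 x y
  touching⇒HeapGen s<t touches-s touches-t isX isY =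
    _ , _ , s<t , touching⇒∣-∣≤1 touches-s touches-t , isX , isY

  module Tracking (creates : (j : Fin (length 𝐢)) → ∃ (IsX n 𝐢 j)) (v a b : ℕ) where

    record Tracked (m : ℕ) : Set where
      constructor tracked
      field
        {t}      : Fin (length 𝐢)
        t<m      : toℕ t < m
        {xₜ}     : ℕ × ℕ
        isXₜ     : IsX n 𝐢 t xₜ
        ab≤xₜ    : HeapLeq n 𝐢 (a , b) xₜ
        {pos}    : ℕ
        v-at     : EntryAt (after m) pos v
        touchesₜ : Touches (lookup 𝐢 t) pos

    start : ∀ {j} → IsX n 𝐢 j (a , b) → v ∈ a ∷ b ∷ [] → Tracked (suc (toℕ j))
    start isX v∈ab with IsX-positions isX
    ... | at-a , at-b with pair-entry-touches v∈ab at-a at-b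
    ...   | _ , at-v , touches with swapAt-keeps-touched at-a at-b at-v touches
    ...     | _ , at-v′ , touches′ = tracked ≤-refl isX ε (after-suc at-v′) touches′

    advance-at : (j : Fin (length 𝐢)) → Tracked (toℕ j) → Tracked (suc (toℕ j))
    advance-at j (tracked t<j isXₜ ab≤xₜ v-at touchesₜ) with creates j
    ... | _ , isXⱼ with IsX-positions isXⱼ | touches? (lookup 𝐢 j) _
    ...   | at-i , at-i+1 | no ¬touches =
      tracked (m≤n⇒m≤1+n t<j) isXₜ ab≤xₜ
        (after-suc (swapAt-keeps-untouched at-i at-i+1 v-at ¬touches)) touchesₜ
    ...   | at-i , at-i+1 | yes touchesⱼ with swapAt-keeps-touched at-i at-i+1 v-at touchesⱼ
    ...     | _ , at-v′ , touches′ =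
      tracked ≤-refl isXⱼ (ab≤xₜ ◅◅ touching⇒HeapGen t<j touchesₜ touchesⱼ isXₜ isXⱼ ◅ ε)
        (after-suc at-v′) touches′

    advance : ∀ m → m < length 𝐢 → Tracked m → Tracked (suc m)
    advance m m<ℓ with fromℕ< m<ℓ | toℕ-fromℕ< m<ℓ
    ... | j | refl = advance-at j

    advance* : ∀ {m m′} → m ≤′ m′ → m′ ≤ length 𝐢 → Tracked m → Tracked m′
    advance* ≤′-refl         _    T = T
    advance* (≤′-step m≤′m′) m′<ℓ T = advance _ m′<ℓ (advance* m≤′m′ (<⇒≤ m′<ℓ) T)

    finish : ∀ {k c d} → IsX n 𝐢 k (c , d) → v ∈ c ∷ d ∷ [] → Tracked (toℕ k) →
             HeapLeq n 𝐢 (a , b) (c , d)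
    finish {k} isX v∈cd (tracked t<k isXₜ ab≤xₜ v-at touchesₜ) with IsX-positions isX
    ... | at-c , at-d with pair-entry-touches v∈cd at-c at-d
    ...   | _ , at-v , touchesₖ
      rewrite EntryAt-injective (Unique-applySwaps (take (toℕ k) 𝐢) (Unique-idPerm n)) v-at at-v =
      ab≤xₜ ◅◅ touching⇒HeapGen t<k touchesₜ touchesₖ isXₜ isX ◅ ε

    common-entry⇒HeapLeq : ∀ {j k c d} → toℕ j < toℕ k → IsX n 𝐢 j (a , b) → IsX n 𝐢 k (c , d) →
      v ∈ a ∷ b ∷ [] → v ∈ c ∷ d ∷ [] → HeapLeq n 𝐢 (a , b) (c , d)
    common-entry⇒HeapLeq {k = k} j<k isXⱼ isXₖ v∈ab v∈cd =
      finish isXₖ v∈cd (advance* (≤⇒≤′ j<k) (<⇒≤ (toℕ<n k)) (start isXⱼ v∈ab))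

  reduced⇒creates : ∀ {w} → ReducedWordFor n w 𝐢 → (j : Fin (length 𝐢)) → ∃ (IsX n 𝐢 j)
  reduced⇒creates (_ , refl , reduced) = every-swap-creates 𝐢 (Unique-idPerm n) (begin
    invCount (prod n 𝐢)         ≡⟨ reduced ⟨
    length 𝐢                    ≡⟨ cong (λ is → length is + length 𝐢) (inv-idPerm n) ⟨
    invCount (idPerm n) + length 𝐢 ∎)
    where open ≡-Reasoning

  inversion⇒IsX : ∀ {x} → x ∈ inv (prod n 𝐢) → ∃ λ j → IsX n 𝐢 j x
  inversion⇒IsX x∈ = first-creation (idPerm n) 𝐢 (λ x∈id → ∉[] (subst (_ ∈_) (inv-idPerm n) x∈id)) x∈

interSize≡1⇒common : ∀ a b c d → interSize a b c d ≡ 1 → ∃ λ v → v ∈ a ∷ b ∷ [] × v ∈ c ∷ d ∷ []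
interSize≡1⇒common a b c d one with a ∈? c ∷ d ∷ [] | b ∈? c ∷ d ∷ []
... | yes a∈cd | _        = a , here refl , a∈cd
... | no _     | yes b∈cd = b , there (here refl) , b∈cd
... | no a∉cd  | no b∉cd  = contradiction (≡.trans (cong length (sym none)) one) λ ()
  where
  none : filter (_∈? c ∷ d ∷ []) (a ∷ b ∷ []) ≡ []
  none = ≡.trans (filter-reject (_∈? c ∷ d ∷ []) a∉cd) (filter-reject (_∈? c ∷ d ∷ []) b∉cd)

interSize-self : ∀ a b → interSize a b a b ≡ 2
interSize-self a b = cong length (≡.trans (filter-accept (_∈? a ∷ b ∷ []) (here refl))
                                         (cong (a ∷_) (filter-accept (_∈? a ∷ b ∷ []) (there (here refl)))))

open Tracking using (common-entry⇒HeapLeq)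

proposition2p2 : (n : ℕ) (w : List ℕ) → w ↭ idPerm n →
    (𝐢 : List ℕ) → ReducedWordFor n w 𝐢 →
    (a b c d : ℕ) → (a , b) ∈ inv w → (c , d) ∈ inv w →
    interSize a b c d ≡ 1 →
    Comparable n 𝐢 (a , b) (c , d)
proposition2p2 n w _ 𝐢 reduced@(_ , refl , _) a b c d ab∈ cd∈ one
  with inversion⇒IsX ab∈ | inversion⇒IsX cd∈ | interSize≡1⇒common a b c d one
... | j , isXⱼ | k , isXₖ | v , v∈ab , v∈cd with <-cmp (toℕ j) (toℕ k)
...   | tri< j<k _ _ = inj₁ (common-entry⇒HeapLeq (reduced⇒creates reduced) v a b j<k isXⱼ isXₖ v∈ab v∈cd)
...   | tri> _ _ k<j = inj₂ (common-entry⇒HeapLeq (reduced⇒creates reduced) v c d k<j isXₖ isXⱼ v∈cd v∈ab)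
...   | tri≈ _ j≡k _ with toℕ-injective j≡k
...     | refl with IsX-functional {n} {𝐢} {j} isXⱼ isXₖ
...       | refl = contradiction (≡.trans (sym (interSize-self a b)) one) λ ()
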